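{- Let $n$ be a positive integer, $s$ an integer with $0\le s\le n$ such that $\lambda=3^{(n+s-1)/2}$ is an integer, and let $D_0,D_1,D_2$ be a partition of $\mathbb{F}_{3^n}$. Suppose each $D_i$ is a partial geometric difference set in the additive group of $\mathbb{F}_{3^n}$ such that $\chi_a(D_i)\in\{0,\pm\lambda,\pm\lambda\zeta_3,\pm\lambda\zeta_3^2\}$ for every nonzero $a\in\mathbb{F}_{3^n}$. Suppose one of the following holds: (i) $|D_0|=|D_1|=|D_2|$; (ii) for some $\{i,j,k\}=\{0,1,2\}$, $|D_i|=|D_j|=3^{n-1}-3^{(n+s-2)/2}$ and $|D_k|=3^{n-1}+2\cdot3^{(n+s-2)/2}$; (iii) for some $\{i,j,k\}=\{0,1,2\}$, $|D_i|=|D_j|=3^{n-1}+3^{(n+s-2)/2}$ and $|D_k|=3^{n-1}-2\cdot3^{(n+s-2)/2}$. Suppose moreover that for every nonzero $a\in\mathbb{F}_{3^n}$, $|\langle z_a,e\rangle|^2\in\{0,3\lambda^2\}$. Then the function $f:\mathbb{F}_{3^n}\to\mathbb{F}_3$ defined by $f(x)=i$ for $x\in D_i$ ($i=0,1,2$) is $s$-plateaued.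
   Context: $\zeta_3=e^{2\pi i/3}$, $Tr_n$ is the absolute trace $\mathbb{F}_{3^n}\to\mathbb{F}_3$, and for $a\in\mathbb{F}_{3^n}$ the additive character is $\chi_a(x)=\zeta_3^{Tr_n(ax)}$, with $\chi_a(S)=\sum_{x\in S}\chi_a(x)$. $z_a=(\chi_a(D_0),\chi_a(D_1),\chi_a(D_2))$, $e=(1,\zeta_3,\zeta_3^2)$, and $\langle u,w\rangle=\sum_{i}u_i\overline{w_i}$ is the complex inner product. A partial geometric difference set in an abelian group $G$ of order $v$ is a $k$-subset $S$ ($v>k>2$) such that, with $\delta(g)=|\{(a,b)\in S\times S:g=a-b\}|$, the sum $\sum_{y\in S}\delta(x-y)$ takes one constant value for all $x\notin S$ and one constant value for all $x\in S$. A function $f:\mathbb{F}_{3^n}\to\mathbb{F}_3$ is $s$-plateaued if $|\widehat f(\mu)|\in\{0,3^{(n+s)/2}\}$ for all $\mu$, where $\widehat f(\mu)=\sum_{x}\zeta_3^{f(x)-Tr_n(\mu x)}$. -}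

module Defs where

open import Level using (0ℓ)
open import Data.Nat as ℕ using (ℕ; zero; suc; _^_; _<_)
open import Data.Integer as ℤ using (ℤ; +_)
open import Data.Fin using (Fin; toℕ) renaming (zero to f0; suc to fs)
open import Data.Fin.Properties using () renaming (_≟_ to _≟F_)
open import Data.Bool using (Bool; true; false; if_then_else_; _∧_)
open import Data.List using (List; []; _∷_; length; filterᵇ; map; foldr)
open import Data.List.Membership.Propositional using (_∈_)
open import Data.List.Relation.Unary.Unique.Propositional using (Unique)
open import Data.Product using (Σ; ∃; _×_; _,_)
open import Data.Empty using (⊥)
open import Data.Sum using (_⊎_)
open import Relation.Nullary using (¬_; Dec; does)
open import Relation.Binary.PropositionalEquality using (_≡_)
open import Relation.Binary.Definitions using (DecidableEquality)
open import Algebra.Structures using (IsCommutativeRing)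

-- The ring ℤ[ζ₃] = {a + bζ₃ : a,b ∈ ℤ}, ζ₃² = -1 - ζ₃.
-- Every value of an additive character (sum) lies in this ring, and
-- {1, ζ₃} is a ℤ-basis, so propositional equality of pairs is
-- equality of complex numbers.

record Zζ : Set where
  constructor _+_ζ
  field
    re : ℤ
    im : ℤ

open Zζ public

0ζ : Zζ
0ζ = (+ 0) + (+ 0) ζ

1ζ : Zζ
1ζ = (+ 1) + (+ 0) ζ

ζ₃ : Zζ
ζ₃ = (+ 0) + (+ 1) ζ

_⊕_ : Zζ → Zζ → Zζ
(a + b ζ) ⊕ (c + d ζ) = (a ℤ.+ c) + (b ℤ.+ d) ζ

-- (a + bζ)(c + dζ) = (ac - bd) + (ad + bc - bd)ζ
_⊗_ : Zζ → Zζ → Zζ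
(a + b ζ) ⊗ (c + d ζ) =
  (a ℤ.* c ℤ.- b ℤ.* d) + (a ℤ.* d ℤ.+ b ℤ.* c ℤ.- b ℤ.* d) ζ

_·ζ_ : ℤ → Zζ → Zζ
k ·ζ (a + b ζ) = (k ℤ.* a) + (k ℤ.* b) ζ

-- complex conjugation: conj(a + bζ) = a + bζ² = (a - b) - bζ
conj : Zζ → Zζ
conj (a + b ζ) = (a ℤ.- b) + (ℤ.- b) ζ

normSq : Zζ → ℤ
normSq (a + b ζ) = a ℤ.* a ℤ.- a ℤ.* b ℤ.+ b ℤ.* b

ζpow : ℕ → Zζ
ζpow zero    = 1ζ
ζpow (suc k) = ζ₃ ⊗ ζpow k

ζ^ : Fin 3 → Zζ
ζ^ t = ζpow (toℕ t)

-- ζ₃^(t - u) for t, u ∈ 𝔽₃   (ζ₃^(t-u) = ζ₃^(t + 2u) since ζ₃³ = 1)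
ζ^diff : Fin 3 → Fin 3 → Zζ
ζ^diff t u = ζpow (toℕ t ℕ.+ 2 ℕ.* toℕ u)

Σζ : {A : Set} → List A → (A → Zζ) → Zζ
Σζ xs f = foldr (λ x acc → f x ⊕ acc) 0ζ xs

Σℕ : {A : Set} → List A → (A → ℕ) → ℕ
Σℕ xs f = foldr (λ x acc → f x ℕ.+ acc) 0 xs

record FiniteField (q : ℕ) : Set₁ where
  field
    F       : Set
    _+F_    : F → F → F
    _*F_    : F → F → F
    -F_     : F → F
    0F      : F
    1F      : F
    isCommutativeRing : IsCommutativeRing _≡_ _+F_ _*F_ -F_ 0F 1F
    0≢1     : ¬ (0F ≡ 1F)
    inverse : (x : F) → ¬ (x ≡ 0F) → Σ F (λ y → x *F y ≡ 1F)
    _≟_     : DecidableEquality F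
    elems   : List F
    elems-unique   : Unique elems
    elems-complete : (x : F) → x ∈ elems
    elems-length   : length elems ≡ q

  _-F_ : F → F → F
  x -F y = x +F (-F y)

  powF : F → ℕ → F
  powF x zero    = 1F
  powF x (suc k) = x *F powF x k

module FieldDefs {n : ℕ} (𝔽 : FiniteField (3 ^ n)) where
  open FiniteField 𝔽

  trAux : ℕ → F → F
  trAux zero    x = 0F
  trAux (suc i) x = powF x (3 ^ i) +F trAux i x

  TrF : F → F
  TrF x = trAux n x

  -- Tr_n viewed as a map into 𝔽₃ = {0, 1, 2} = Fin 3
  -- (its values lie in the prime field {0F, 1F, 1F + 1F}).
  Tr : F → Fin 3
  Tr x = if does (TrF x ≟ 0F) then f0
         else if does (TrF x ≟ 1F) then fs f0
         else fs (fs f0)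

  χ : F → F → Zζ
  χ a x = ζ^ (Tr (a *F x))

  Subset : Set
  Subset = F → Bool

  χS : F → Subset → Zζ
  χS a S = Σζ (filterᵇ S elems) (χ a)

  ∣_∣ : Subset → ℕ
  ∣ S ∣ = length (filterᵇ S elems)

  δ : Subset → F → ℕ
  δ S g = Σℕ (filterᵇ S elems) (λ a →
            length (filterᵇ (λ b → S b ∧ does (g ≟ (a -F b))) elems))

  IsPGDS : Subset → Set
  IsPGDS S =
    2 < ∣ S ∣ × ∣ S ∣ < 3 ^ n ×
    Σ ℕ (λ α → Σ ℕ (λ β →
      ((x : F) → S x ≡ false → Σℕ (filterᵇ S elems) (λ y → δ S (x -F y)) ≡ α) ×
      ((x : F) → S x ≡ true  → Σℕ (filterᵇ S elems) (λ y → δ S (x -F y)) ≡ β)))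

  walsh : (F → Fin 3) → F → Zζ
  walsh f μ = Σζ elems (λ x → ζ^diff (f x) (Tr (μ *F x)))

  -- s-plateaued: |f̂(μ)| ∈ {0, 3^((n+s)/2)}, equivalently
  -- |f̂(μ)|² ∈ {0, 3^(n+s)}  (absolute values are nonnegative reals)
  IsPlateaued : ℕ → (F → Fin 3) → Set
  IsPlateaued s f = (μ : F) →
    (normSq (walsh f μ) ≡ + 0) ⊎ (normSq (walsh f μ) ≡ + (3 ^ (n ℕ.+ s)))

  D : (F → Fin 3) → Fin 3 → Subset
  D d i x = does (d x ≟F i)

  z : (F → Fin 3) → F → Fin 3 → Zζ
  z d a i = χS a (D d i)

  e : Fin 3 → Zζ
  e i = ζ^ i

  ⟨z,e⟩ : (F → Fin 3) → F → Zζ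
  ⟨z,e⟩ d a = (z d a f0 ⊗ conj (e f0)) ⊕
              ((z d a (fs f0) ⊗ conj (e (fs f0))) ⊕
               (z d a (fs (fs f0)) ⊗ conj (e (fs (fs f0)))))

module Submission where

-- The Walsh transform of f splits along the partition:
--   f̂(μ) = Σ_x ζ^{f(x)} conj(ζ^{Tr(μx)}) = conj (Σ_i χ_μ(D_i) conj(ζ^i)) = conj ⟨z_μ, e⟩,
-- so |f̂(μ)|² = |⟨z_μ, e⟩|².  For μ ≠ 0 the hypothesis |⟨z_μ,e⟩|² ∈ {0, 3λ²}
-- therefore gives |f̂(μ)|² ∈ {0, 3^(n+s)}, because 3λ² = 3^(2m+1) = 3^(n+s).
-- For μ = 0 the trace vanishes and f̂(0) = Σ_i |D_i| ζ^i, whose squared modulus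
-- is the symmetric quadratic form Q(a,b,c) = a²+b²+c²-ab-bc-ca of the sizes.
-- When two sizes equal x and the third equals y, Q = (x - y)²; the three size
-- conditions give x - y = 0, -3t or 3t, hence |f̂(0)|² ∈ {0, 9t²} = {0, 3^(n+s)}.

open import Defs
open import Data.Nat as ℕ using (ℕ; zero; suc; _^_; _≤_; _*_; _+_; _∸_; _<_)
import Data.Nat.Properties as ℕP
open import Data.Integer as ℤ using (ℤ; +_)
import Data.Integer.Properties as ℤP
open import Data.Integer.Tactic.RingSolver using (solve-∀)
open import Data.Fin using (Fin) renaming (zero to f0; suc to fs)
open import Data.Fin.Properties using () renaming (_≟_ to _≟F_)
open import Data.Bool using (Bool; true; false; if_then_else_)
open import Data.List using (List; []; _∷_; filterᵇ; length)
open import Data.Product using (Σ; _×_; _,_)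
open import Data.Sum using (_⊎_; inj₁; inj₂)
import Data.Sum as Sum
open import Data.Empty using (⊥-elim)
open import Relation.Nullary using (¬_; does; yes; no)
open import Relation.Binary.PropositionalEquality
open import Algebra.Structures using (IsCommutativeRing)

⊕-identityˡ : ∀ w → 0ζ ⊕ w ≡ w
⊕-identityˡ (a + b ζ) = cong₂ _+_ζ (lemma a) (lemma b)
  where lemma : ∀ (a : ℤ) → + 0 ℤ.+ a ≡ a
        lemma = solve-∀

⊕-interchange : ∀ w x y v → (w ⊕ x) ⊕ (y ⊕ v) ≡ (w ⊕ y) ⊕ (x ⊕ v)
⊕-interchange (a + b ζ) (c + d ζ) (e + f ζ) (g + h ζ) =
  cong₂ _+_ζ (lemma a c e g) (lemma b d f h)
  where lemma : ∀ (a b c d : ℤ) → (a ℤ.+ b) ℤ.+ (c ℤ.+ d) ≡ (a ℤ.+ c) ℤ.+ (b ℤ.+ d)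
        lemma = solve-∀

⊗-zeroˡ : ∀ w → 0ζ ⊗ w ≡ 0ζ
⊗-zeroˡ (a + b ζ) = cong₂ _+_ζ (re-part a b) (im-part a b)
  where re-part : ∀ (a b : ℤ) → + 0 ℤ.* a ℤ.- + 0 ℤ.* b ≡ + 0
        re-part = solve-∀
        im-part : ∀ (a b : ℤ) → + 0 ℤ.* b ℤ.+ + 0 ℤ.* a ℤ.- + 0 ℤ.* b ≡ + 0
        im-part = solve-∀

⊗-distribʳ-⊕ : ∀ w x c → (w ⊕ x) ⊗ c ≡ (w ⊗ c) ⊕ (x ⊗ c)
⊗-distribʳ-⊕ (a + b ζ) (e + f ζ) (c + d ζ) =
  cong₂ _+_ζ (re-part a b e f c d) (im-part a b e f c d)
  where
    re-part : ∀ (a b e f c d : ℤ) →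
      (a ℤ.+ e) ℤ.* c ℤ.- (b ℤ.+ f) ℤ.* d
        ≡ (a ℤ.* c ℤ.- b ℤ.* d) ℤ.+ (e ℤ.* c ℤ.- f ℤ.* d)
    re-part = solve-∀
    im-part : ∀ (a b e f c d : ℤ) →
      (a ℤ.+ e) ℤ.* d ℤ.+ (b ℤ.+ f) ℤ.* c ℤ.- (b ℤ.+ f) ℤ.* d
        ≡ (a ℤ.* d ℤ.+ b ℤ.* c ℤ.- b ℤ.* d) ℤ.+ (e ℤ.* d ℤ.+ f ℤ.* c ℤ.- f ℤ.* d)
    im-part = solve-∀

conj-⊕ : ∀ w x → conj (w ⊕ x) ≡ conj w ⊕ conj x
conj-⊕ (a + b ζ) (c + d ζ) = cong₂ _+_ζ (re-part a b c d) (im-part b d)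
  where re-part : ∀ (a b c d : ℤ) → (a ℤ.+ c) ℤ.- (b ℤ.+ d) ≡ (a ℤ.- b) ℤ.+ (c ℤ.- d)
        re-part = solve-∀
        im-part : ∀ (b d : ℤ) → ℤ.- (b ℤ.+ d) ≡ (ℤ.- b) ℤ.+ (ℤ.- d)
        im-part = solve-∀

normSq-conj : ∀ w → normSq (conj w) ≡ normSq w
normSq-conj (a + b ζ) = lemma a b
  where lemma : ∀ (a b : ℤ) →
          (a ℤ.- b) ℤ.* (a ℤ.- b) ℤ.- (a ℤ.- b) ℤ.* (ℤ.- b) ℤ.+ (ℤ.- b) ℤ.* (ℤ.- b)
            ≡ a ℤ.* a ℤ.- a ℤ.* b ℤ.+ b ℤ.* b
        lemma = solve-∀

-- coordinate updates when one more term 1 or ζ² = -1 - ζ is added to a count sum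
one-plus-difference : ∀ (a b : ℤ) → + 1 ℤ.+ (a ℤ.- b) ≡ (+ 1 ℤ.+ a) ℤ.- b
one-plus-difference = solve-∀

minus-one-plus-difference : ∀ (a b : ℤ) → ℤ.- (+ 1) ℤ.+ (a ℤ.- b) ≡ a ℤ.- (+ 1 ℤ.+ b)
minus-one-plus-difference = solve-∀

module _ {A : Set} where

  Σζ-filter : ∀ (p : A → Bool) (g : A → Zζ) xs →
    Σζ (filterᵇ p xs) g ≡ Σζ xs (λ x → if p x then g x else 0ζ)
  Σζ-filter p g [] = refl
  Σζ-filter p g (x ∷ xs) with p x
  ... | true  = cong (g x ⊕_) (Σζ-filter p g xs)
  ... | false = trans (Σζ-filter p g xs) (sym (⊕-identityˡ _))

  Σζ-⊗ : ∀ (g : A → Zζ) c xs → Σζ xs g ⊗ c ≡ Σζ xs (λ x → g x ⊗ c)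
  Σζ-⊗ g c []       = ⊗-zeroˡ c
  Σζ-⊗ g c (x ∷ xs) =
    trans (⊗-distribʳ-⊕ (g x) _ c) (cong ((g x ⊗ c) ⊕_) (Σζ-⊗ g c xs))

  Σζ-⊕ : ∀ (g h : A → Zζ) xs → Σζ xs g ⊕ Σζ xs h ≡ Σζ xs (λ x → g x ⊕ h x)
  Σζ-⊕ g h []       = refl
  Σζ-⊕ g h (x ∷ xs) =
    trans (⊕-interchange (g x) _ (h x) _) (cong ((g x ⊕ h x) ⊕_) (Σζ-⊕ g h xs))

  Σζ-conj : ∀ (g : A → Zζ) xs → conj (Σζ xs g) ≡ Σζ xs (λ x → conj (g x))
  Σζ-conj g []       = refl
  Σζ-conj g (x ∷ xs) = trans (conj-⊕ (g x) _) (cong (conj (g x) ⊕_) (Σζ-conj g xs))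

  Σζ-cong : ∀ {g h : A → Zζ} xs → (∀ x → g x ≡ h x) → Σζ xs g ≡ Σζ xs h
  Σζ-cong []       eq = refl
  Σζ-cong (x ∷ xs) eq = cong₂ _⊕_ (eq x) (Σζ-cong xs eq)

  count : (c : A → Fin 3) → Fin 3 → List A → ℤ
  count c i xs = + length (filterᵇ (λ x → does (c x ≟F i)) xs)

  -- Σ_x ζ^{c(x)} = n₀ + n₁ζ + n₂ζ² = (n₀ - n₂) + (n₁ - n₂)ζ, where n_i counts c⁻¹(i);
  -- an element of class 2 contributes ζ² = -1 - ζ, lowering both coordinates
  Σζ-count : (c : A → Fin 3) (xs : List A) →
    Σζ xs (λ x → ζ^diff (c x) f0)
      ≡ (count c f0 xs ℤ.- count c (fs (fs f0)) xs) + (count c (fs f0) xs ℤ.- count c (fs (fs f0)) xs) ζ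
  Σζ-count c [] = refl
  Σζ-count c (x ∷ xs) with c x | Σζ-count c xs
  ... | f0 | ih = trans (cong (1ζ ⊕_) ih)
      (cong₂ _+_ζ (one-plus-difference (count c f0 xs) (count c (fs (fs f0)) xs))
                  (ℤP.+-identityˡ (count c (fs f0) xs ℤ.- count c (fs (fs f0)) xs)))
  ... | fs f0 | ih = trans (cong (ζ₃ ⊕_) ih)
      (cong₂ _+_ζ (ℤP.+-identityˡ (count c f0 xs ℤ.- count c (fs (fs f0)) xs))
                  (one-plus-difference (count c (fs f0) xs) (count c (fs (fs f0)) xs)))
  ... | fs (fs f0) | ih = trans (cong (((ℤ.- (+ 1)) + (ℤ.- (+ 1)) ζ) ⊕_) ih)
      (cong₂ _+_ζ (minus-one-plus-difference (count c f0 xs) (count c (fs (fs f0)) xs))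
                  (minus-one-plus-difference (count c (fs f0) xs) (count c (fs (fs f0)) xs)))

-- The quadratic form Q(a,b,c) = |a + bζ + cζ²|².

Q : ℤ → ℤ → ℤ → ℤ
Q a b c = a ℤ.* a ℤ.+ b ℤ.* b ℤ.+ c ℤ.* c ℤ.- a ℤ.* b ℤ.- b ℤ.* c ℤ.- c ℤ.* a

normSq-Q : ∀ a b c → normSq ((a ℤ.- c) + (b ℤ.- c) ζ) ≡ Q a b c
normSq-Q = lemma
  where lemma : ∀ (a b c : ℤ) →
          (a ℤ.- c) ℤ.* (a ℤ.- c) ℤ.- (a ℤ.- c) ℤ.* (b ℤ.- c) ℤ.+ (b ℤ.- c) ℤ.* (b ℤ.- c)
            ≡ a ℤ.* a ℤ.+ b ℤ.* b ℤ.+ c ℤ.* c ℤ.- a ℤ.* b ℤ.- b ℤ.* c ℤ.- c ℤ.* a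
        lemma = solve-∀

Q-cong : ∀ {a a′ b b′ c c′} → a ≡ a′ → b ≡ b′ → c ≡ c′ → Q a b c ≡ Q a′ b′ c′
Q-cong refl refl refl = refl

Q-xxy : ∀ x y → Q x x y ≡ (x ℤ.- y) ℤ.* (x ℤ.- y)
Q-xxy = lemma
  where lemma : ∀ (x y : ℤ) →
          x ℤ.* x ℤ.+ x ℤ.* x ℤ.+ y ℤ.* y ℤ.- x ℤ.* x ℤ.- x ℤ.* y ℤ.- y ℤ.* x
            ≡ (x ℤ.- y) ℤ.* (x ℤ.- y)
        lemma = solve-∀

Q-xyx : ∀ x y → Q x y x ≡ (x ℤ.- y) ℤ.* (x ℤ.- y)
Q-xyx = lemma
  where lemma : ∀ (x y : ℤ) →
          x ℤ.* x ℤ.+ y ℤ.* y ℤ.+ x ℤ.* x ℤ.- x ℤ.* y ℤ.- y ℤ.* x ℤ.- x ℤ.* x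
            ≡ (x ℤ.- y) ℤ.* (x ℤ.- y)
        lemma = solve-∀

Q-yxx : ∀ x y → Q y x x ≡ (x ℤ.- y) ℤ.* (x ℤ.- y)
Q-yxx = lemma
  where lemma : ∀ (x y : ℤ) →
          y ℤ.* y ℤ.+ x ℤ.* x ℤ.+ x ℤ.* x ℤ.- y ℤ.* x ℤ.- x ℤ.* x ℤ.- x ℤ.* y
            ≡ (x ℤ.- y) ℤ.* (x ℤ.- y)
        lemma = solve-∀

Q-two-equal : (g : Fin 3 → ℤ) (i j k : Fin 3) → ¬ i ≡ j → ¬ j ≡ k → ¬ i ≡ k →
  ∀ {x y} → g i ≡ x → g j ≡ x → g k ≡ y →
  Q (g f0) (g (fs f0)) (g (fs (fs f0))) ≡ (x ℤ.- y) ℤ.* (x ℤ.- y)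
Q-two-equal g f0 f0 _ i≢j _ _ = ⊥-elim (i≢j refl)
Q-two-equal g (fs f0) (fs f0) _ i≢j _ _ = ⊥-elim (i≢j refl)
Q-two-equal g (fs (fs f0)) (fs (fs f0)) _ i≢j _ _ = ⊥-elim (i≢j refl)
Q-two-equal g f0 (fs f0) f0 _ _ i≢k = ⊥-elim (i≢k refl)
Q-two-equal g f0 (fs f0) (fs f0) _ j≢k _ = ⊥-elim (j≢k refl)
Q-two-equal g f0 (fs f0) (fs (fs f0)) _ _ _ {x} {y} p₀ p₁ p₂ = trans (Q-cong p₀ p₁ p₂) (Q-xxy x y)
Q-two-equal g f0 (fs (fs f0)) f0 _ _ i≢k = ⊥-elim (i≢k refl)
Q-two-equal g f0 (fs (fs f0)) (fs f0) _ _ _ {x} {y} p₀ p₂ p₁ = trans (Q-cong p₀ p₁ p₂) (Q-xyx x y)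
Q-two-equal g f0 (fs (fs f0)) (fs (fs f0)) _ j≢k _ = ⊥-elim (j≢k refl)
Q-two-equal g (fs f0) f0 f0 _ j≢k _ = ⊥-elim (j≢k refl)
Q-two-equal g (fs f0) f0 (fs f0) _ _ i≢k = ⊥-elim (i≢k refl)
Q-two-equal g (fs f0) f0 (fs (fs f0)) _ _ _ {x} {y} p₁ p₀ p₂ = trans (Q-cong p₀ p₁ p₂) (Q-xxy x y)
Q-two-equal g (fs f0) (fs (fs f0)) f0 _ _ _ {x} {y} p₁ p₂ p₀ = trans (Q-cong p₀ p₁ p₂) (Q-yxx x y)
Q-two-equal g (fs f0) (fs (fs f0)) (fs f0) _ _ i≢k = ⊥-elim (i≢k refl)
Q-two-equal g (fs f0) (fs (fs f0)) (fs (fs f0)) _ j≢k _ = ⊥-elim (j≢k refl)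
Q-two-equal g (fs (fs f0)) f0 f0 _ j≢k _ = ⊥-elim (j≢k refl)
Q-two-equal g (fs (fs f0)) f0 (fs f0) _ _ _ {x} {y} p₂ p₀ p₁ = trans (Q-cong p₀ p₁ p₂) (Q-xyx x y)
Q-two-equal g (fs (fs f0)) f0 (fs (fs f0)) _ _ i≢k = ⊥-elim (i≢k refl)
Q-two-equal g (fs (fs f0)) (fs f0) f0 _ _ _ {x} {y} p₂ p₁ p₀ = trans (Q-cong p₀ p₁ p₂) (Q-yxx x y)
Q-two-equal g (fs (fs f0)) (fs f0) (fs f0) _ j≢k _ = ⊥-elim (j≢k refl)
Q-two-equal g (fs (fs f0)) (fs f0) (fs (fs f0)) _ _ i≢k = ⊥-elim (i≢k refl)

nine-t² : ∀ t → + 9 ℤ.* (+ t ℤ.* + t) ≡ + (9 * (t * t))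
nine-t² t = trans (cong (+ 9 ℤ.*_) (sym (ℤP.pos-* t t))) (sym (ℤP.pos-* 9 (t * t)))

-- The three admissible size patterns (i), (ii), (iii) for g = (|D₀|, |D₁|, |D₂|),
-- with N = 3^(n-1) and P = 3^(n+s).
SizePattern : (N P : ℕ) → (Fin 3 → ℕ) → Set
SizePattern N P g =
  (g f0 ≡ g (fs f0) × g (fs f0) ≡ g (fs (fs f0))) ⊎
  Σ ℕ (λ t → 9 * (t * t) ≡ P ×
    Σ (Fin 3) (λ i → Σ (Fin 3) (λ j → Σ (Fin 3) (λ k →
      ¬ (i ≡ j) × ¬ (j ≡ k) × ¬ (i ≡ k) ×
      + g i ≡ + N ℤ.- + t × + g j ≡ + N ℤ.- + t × + g k ≡ + N ℤ.+ + (2 * t))))) ⊎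
  Σ ℕ (λ t → 9 * (t * t) ≡ P ×
    Σ (Fin 3) (λ i → Σ (Fin 3) (λ j → Σ (Fin 3) (λ k →
      ¬ (i ≡ j) × ¬ (j ≡ k) × ¬ (i ≡ k) ×
      + g i ≡ + N ℤ.+ + t × + g j ≡ + N ℤ.+ + t × + g k ≡ + N ℤ.- + (2 * t)))))

-- Under each size pattern Q(|D₀|,|D₁|,|D₂|) ∈ {0, 9t²} = {0, P}:
-- the difference x - y of the two sizes is 0, -3t or 3t.
Q-of-sizes : ∀ N P (g : Fin 3 → ℕ) → SizePattern N P g →
  let Qg = Q (+ g f0) (+ g (fs f0)) (+ g (fs (fs f0))) in (Qg ≡ + 0) ⊎ (Qg ≡ + P)
Q-of-sizes N P g (inj₁ (g₀≡g₁ , g₁≡g₂)) = inj₁ (begin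
  Q (+ g f0) (+ g (fs f0)) (+ g (fs (fs f0)))
    ≡⟨ Q-two-equal (λ i → + g i) f0 (fs f0) (fs (fs f0)) (λ ()) (λ ()) (λ ())
         refl (cong +_ (sym g₀≡g₁)) (cong +_ (sym (trans g₀≡g₁ g₁≡g₂))) ⟩
  (+ g f0 ℤ.- + g f0) ℤ.* (+ g f0 ℤ.- + g f0)
    ≡⟨ square-of-zero (+ g f0) ⟩
  + 0 ∎)
  where open ≡-Reasoning
        square-of-zero : ∀ (x : ℤ) → (x ℤ.- x) ℤ.* (x ℤ.- x) ≡ + 0
        square-of-zero = solve-∀
Q-of-sizes N P g (inj₂ (inj₁ (t , 9t²≡P , i , j , k , i≢j , j≢k , i≢k , gi , gj , gk))) =
  inj₂ (begin
    Q (+ g f0) (+ g (fs f0)) (+ g (fs (fs f0)))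
      ≡⟨ Q-two-equal (λ i → + g i) i j k i≢j j≢k i≢k gi gj (trans gk (cong (λ u → + N ℤ.+ u) (ℤP.pos-* 2 t))) ⟩
    ((+ N ℤ.- + t) ℤ.- (+ N ℤ.+ + 2 ℤ.* + t)) ℤ.* ((+ N ℤ.- + t) ℤ.- (+ N ℤ.+ + 2 ℤ.* + t))
      ≡⟨ difference-3t (+ N) (+ t) ⟩
    + 9 ℤ.* (+ t ℤ.* + t)
      ≡⟨ nine-t² t ⟩
    + (9 * (t * t))
      ≡⟨ cong +_ 9t²≡P ⟩
    + P ∎)
  where open ≡-Reasoning
        difference-3t : ∀ (N t : ℤ) →
          ((N ℤ.- t) ℤ.- (N ℤ.+ + 2 ℤ.* t)) ℤ.* ((N ℤ.- t) ℤ.- (N ℤ.+ + 2 ℤ.* t))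
            ≡ + 9 ℤ.* (t ℤ.* t)
        difference-3t = solve-∀
Q-of-sizes N P g (inj₂ (inj₂ (t , 9t²≡P , i , j , k , i≢j , j≢k , i≢k , gi , gj , gk))) =
  inj₂ (begin
    Q (+ g f0) (+ g (fs f0)) (+ g (fs (fs f0)))
      ≡⟨ Q-two-equal (λ i → + g i) i j k i≢j j≢k i≢k gi gj (trans gk (cong (λ u → + N ℤ.- u) (ℤP.pos-* 2 t))) ⟩
    ((+ N ℤ.+ + t) ℤ.- (+ N ℤ.- + 2 ℤ.* + t)) ℤ.* ((+ N ℤ.+ + t) ℤ.- (+ N ℤ.- + 2 ℤ.* + t))
      ≡⟨ difference-3t (+ N) (+ t) ⟩
    + 9 ℤ.* (+ t ℤ.* + t)
      ≡⟨ nine-t² t ⟩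
    + (9 * (t * t))
      ≡⟨ cong +_ 9t²≡P ⟩
    + P ∎)
  where open ≡-Reasoning
        difference-3t : ∀ (N t : ℤ) →
          ((N ℤ.+ t) ℤ.- (N ℤ.- + 2 ℤ.* t)) ℤ.* ((N ℤ.+ t) ℤ.- (N ℤ.- + 2 ℤ.* t))
            ≡ + 9 ℤ.* (t ℤ.* t)
        difference-3t = solve-∀

three-λ² : ∀ m → 3 * (3 ^ m * 3 ^ m) ≡ 3 ^ (2 * m + 1)
three-λ² m = sym (begin
  3 ^ (2 * m + 1)       ≡⟨ ℕP.^-distribˡ-+-* 3 (2 * m) 1 ⟩
  3 ^ (m + (m + 0)) * 3 ≡⟨ cong (λ k → 3 ^ (m + k) * 3) (ℕP.+-identityʳ m) ⟩
  3 ^ (m + m) * 3       ≡⟨ cong (_* 3) (ℕP.^-distribˡ-+-* 3 m m) ⟩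
  3 ^ m * 3 ^ m * 3     ≡⟨ ℕP.*-comm (3 ^ m * 3 ^ m) 3 ⟩
  3 * (3 ^ m * 3 ^ m)   ∎)
  where open ≡-Reasoning

module WalshTransform {n : ℕ} (𝔽 : FiniteField (3 ^ n)) where
  open FiniteField 𝔽
  open FieldDefs {n} 𝔽
  open IsCommutativeRing isCommutativeRing using (zeroˡ; +-identityˡ)

  -- 0^k = 0 for k > 0, so every partial trace of 0 vanishes
  trAux-zero : ∀ i → trAux i 0F ≡ 0F
  trAux-zero zero    = refl
  trAux-zero (suc i) =
    trans (cong₂ _+F_ (zero-pow (3 ^ i) (ℕP.m^n>0 3 i)) (trAux-zero i)) (+-identityˡ 0F)
    where zero-pow : ∀ k → 0 < k → powF 0F k ≡ 0F
          zero-pow (suc k) _ = zeroˡ _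

  Tr-zero : ∀ x → Tr (0F *F x) ≡ f0
  Tr-zero x rewrite zeroˡ x | trAux-zero n with 0F ≟ 0F
  ... | yes _  = refl
  ... | no 0≢0 = ⊥-elim (0≢0 refl)

  -- pointwise identity behind f̂ = conj ⟨z,e⟩: with exactly one indicator
  -- [i = j] nonzero, conj (Σ_j [i = j] ζ^t conj(ζ^j)) = ζ^(i - t)
  split-by-class : ∀ (i t : Fin 3) →
    conj ((((if does (i ≟F f0) then ζ^ t else 0ζ) ⊗ conj (ζ^ f0)) ⊕
           (((if does (i ≟F fs f0) then ζ^ t else 0ζ) ⊗ conj (ζ^ (fs f0))) ⊕
            ((if does (i ≟F fs (fs f0)) then ζ^ t else 0ζ) ⊗ conj (ζ^ (fs (fs f0)))))))
    ≡ ζ^diff i t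
  split-by-class f0           f0           = refl
  split-by-class f0           (fs f0)      = refl
  split-by-class f0           (fs (fs f0)) = refl
  split-by-class (fs f0)      f0           = refl
  split-by-class (fs f0)      (fs f0)      = refl
  split-by-class (fs f0)      (fs (fs f0)) = refl
  split-by-class (fs (fs f0)) f0           = refl
  split-by-class (fs (fs f0)) (fs f0)      = refl
  split-by-class (fs (fs f0)) (fs (fs f0)) = refl

  -- f̂(μ) = conj ⟨z_μ, e⟩: expand each χ_μ(D_i) as a sum over all of 𝔽,
  -- merge the three sums, and identify the summands
  walsh≡conj⟨z,e⟩ : ∀ d μ → walsh d μ ≡ conj (⟨z,e⟩ d μ)
  walsh≡conj⟨z,e⟩ d μ = sym (begin
    conj (⟨z,e⟩ d μ)
      ≡⟨ cong conj (cong₂ _⊕_ (term f0) (cong₂ _⊕_ (term (fs f0)) (term (fs (fs f0))))) ⟩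
    conj (Σζ elems (summand f0) ⊕ (Σζ elems (summand (fs f0)) ⊕ Σζ elems (summand (fs (fs f0)))))
      ≡⟨ cong conj (trans (cong (Σζ elems (summand f0) ⊕_) (Σζ-⊕ (summand (fs f0)) (summand (fs (fs f0))) elems))
                          (Σζ-⊕ (summand f0) (λ x → summand (fs f0) x ⊕ summand (fs (fs f0)) x) elems)) ⟩
    conj (Σζ elems total)
      ≡⟨ Σζ-conj total elems ⟩
    Σζ elems (λ x → conj (total x))
      ≡⟨ Σζ-cong {h = λ x → ζ^diff (d x) (Tr (μ *F x))} elems (λ x → split-by-class (d x) (Tr (μ *F x))) ⟩
    walsh d μ ∎)
    where
      open ≡-Reasoning
      summand : Fin 3 → F → Zζ
      summand i x = (if D d i x then χ μ x else 0ζ) ⊗ conj (ζ^ i)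
      total : F → Zζ
      total x = summand f0 x ⊕ (summand (fs f0) x ⊕ summand (fs (fs f0)) x)
      term : ∀ i → χS μ (D d i) ⊗ conj (ζ^ i) ≡ Σζ elems (summand i)
      term i = trans (cong (_⊗ conj (ζ^ i)) (Σζ-filter (D d i) (χ μ) elems))
                     (Σζ-⊗ (λ x → if D d i x then χ μ x else 0ζ) (conj (ζ^ i)) elems)

  normSq-walsh : ∀ d μ → normSq (walsh d μ) ≡ normSq (⟨z,e⟩ d μ)
  normSq-walsh d μ = trans (cong normSq (walsh≡conj⟨z,e⟩ d μ)) (normSq-conj (⟨z,e⟩ d μ))

  normSq-walsh-zero : ∀ d →
    normSq (walsh d 0F) ≡ Q (+ ∣ D d f0 ∣) (+ ∣ D d (fs f0) ∣) (+ ∣ D d (fs (fs f0)) ∣)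
  normSq-walsh-zero d = begin
    normSq (walsh d 0F)
      ≡⟨ cong normSq (Σζ-cong elems (λ x → cong (ζ^diff (d x)) (Tr-zero x))) ⟩
    normSq (Σζ elems (λ x → ζ^diff (d x) f0))
      ≡⟨ cong normSq (Σζ-count d elems) ⟩
    normSq ((+ ∣ D d f0 ∣ ℤ.- + ∣ D d (fs (fs f0)) ∣) + (+ ∣ D d (fs f0) ∣ ℤ.- + ∣ D d (fs (fs f0)) ∣) ζ)
      ≡⟨ normSq-Q (+ ∣ D d f0 ∣) (+ ∣ D d (fs f0) ∣) (+ ∣ D d (fs (fs f0)) ∣) ⟩
    Q (+ ∣ D d f0 ∣) (+ ∣ D d (fs f0) ∣) (+ ∣ D d (fs (fs f0)) ∣) ∎
    where open ≡-Reasoning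

-- The theorem. Only the size pattern and the values of |⟨z_a, e⟩|² are needed.

mainTheorem4 : (n s m : ℕ) → 1 ≤ n → s ≤ n →
    2 * m + 1 ≡ n + s →
    (𝔽 : FiniteField (3 ^ n)) →
    let open FiniteField 𝔽 in
    let open FieldDefs {n} 𝔽 in
    let λ₀ = 3 ^ m in
    (d : F → Fin 3) →
    ((i : Fin 3) → IsPGDS (D d i)) →
    ((a : F) → ¬ (a ≡ 0F) → (i : Fin 3) →
    (χS a (D d i) ≡ 0ζ) ⊎
    Σ (Fin 3) (λ j → (χS a (D d i) ≡ (+ λ₀) ·ζ ζ^ j) ⊎
    (χS a (D d i) ≡ (ℤ.- (+ λ₀)) ·ζ ζ^ j))) →
    ((∣ D d f0 ∣ ≡ ∣ D d (fs f0) ∣ × ∣ D d (fs f0) ∣ ≡ ∣ D d (fs (fs f0)) ∣) ⊎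
    Σ ℕ (λ t → 9 * (t * t) ≡ 3 ^ (n + s) ×
    Σ (Fin 3) (λ i → Σ (Fin 3) (λ j → Σ (Fin 3) (λ k →
    ¬ (i ≡ j) × ¬ (j ≡ k) × ¬ (i ≡ k) ×
    + ∣ D d i ∣ ≡ + (3 ^ (n ∸ 1)) ℤ.- + t ×
    + ∣ D d j ∣ ≡ + (3 ^ (n ∸ 1)) ℤ.- + t ×
    + ∣ D d k ∣ ≡ + (3 ^ (n ∸ 1)) ℤ.+ + (2 * t))))) ⊎
    Σ ℕ (λ t → 9 * (t * t) ≡ 3 ^ (n + s) ×
    Σ (Fin 3) (λ i → Σ (Fin 3) (λ j → Σ (Fin 3) (λ k →
    ¬ (i ≡ j) × ¬ (j ≡ k) × ¬ (i ≡ k) ×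
    + ∣ D d i ∣ ≡ + (3 ^ (n ∸ 1)) ℤ.+ + t ×
    + ∣ D d j ∣ ≡ + (3 ^ (n ∸ 1)) ℤ.+ + t ×
    + ∣ D d k ∣ ≡ + (3 ^ (n ∸ 1)) ℤ.- + (2 * t)))))) →
    ((a : F) → ¬ (a ≡ 0F) →
    (normSq (⟨z,e⟩ d a) ≡ + 0) ⊎ (normSq (⟨z,e⟩ d a) ≡ + (3 * (λ₀ * λ₀)))) →
    IsPlateaued s d
mainTheorem4 n s m _ _ 2m+1≡n+s 𝔽 d _ _ sizes ⟨z,e⟩-values μ with μ ≟ 0F
  where open FiniteField 𝔽
... | yes refl =
  -- μ = 0: |f̂(0)|² is the quadratic form of the class sizes
  Sum.map (trans (normSq-walsh-zero d)) (trans (normSq-walsh-zero d))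
          (Q-of-sizes (3 ^ (n ∸ 1)) (3 ^ (n + s)) (λ i → ∣ D d i ∣) sizes)
  where open FieldDefs {n} 𝔽
        open WalshTransform {n} 𝔽
... | no μ≢0 =
  -- μ ≠ 0: |f̂(μ)|² = |⟨z_μ, e⟩|² ∈ {0, 3λ²} and 3λ² = 3^(n+s)
  Sum.map (trans (normSq-walsh d μ))
          (λ h → trans (normSq-walsh d μ) (trans h (cong +_ 3λ²≡3^[n+s])))
          (⟨z,e⟩-values μ μ≢0)
  where open FieldDefs {n} 𝔽
        open WalshTransform {n} 𝔽
        3λ²≡3^[n+s] : 3 * (3 ^ m * 3 ^ m) ≡ 3 ^ (n + s)
        3λ²≡3^[n+s] = trans (three-λ² m) (cong (3 ^_) 2m+1≡n+s)
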